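{- Let $\mathcal{M}$ be a 3-orbit $(n-1)$-maniplex. (1) If $\mathcal{M}$ is in class $3^i$ for some $i\in\{1,\dots,n-2\}$, then $\{\alpha_j,\ \alpha_{i,i-1,i+1,i},\ \alpha_{i,i+1,i+2,i+1,i},\ \alpha_{i,i+1,i,i+1,i}\mid j\in\{0,\dots,n-1\}\setminus\{i\}\}$ is a generating set of $\mathrm{Aut}(\mathcal{M})$. (2) If $\mathcal{M}$ is in class $3^{i,i+1}$ for some $i\in\{0,\dots,n-2\}$, then $\{\alpha_j,\ \alpha_{i,i-1,i},\ \alpha_{i,i+1,i+2,i+1,i},\ \alpha_{i,i+1,i,i+1,i}\mid j\in\{0,\dots,n-1\}\setminus\{i\}\}$ is a generating set of $\mathrm{Aut}(\mathcal{M})$. Here the base flag $\Phi$ is chosen so that $\Phi^j$ lies in the $\mathrm{Aut}(\mathcal{M})$-orbit of $\Phi$ for every $j\neq i$, and any $\alpha$ whose indices fall outside $\{0,\dots,n-1\}$ is understood to be the identity.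
   Context: An $(n-1)$-maniplex is given by a connected simple graph (flag graph), whose vertices are called flags, with a proper edge-colouring by colours $\{0,\dots,n-1\}$, each colour class a perfect matching, such that for colours $i,j$ with $|i-j|\ge2$ each component of the subgraph spanned by colours $i,j$ is a 4-cycle. $\Phi^{c_1,\dots,c_m}$ denotes the flag reached from $\Phi$ by successively passing to the $c_1$-, $c_2$-, …, $c_m$-adjacent flags. Automorphisms are colour-preserving graph automorphisms; 3-orbit means exactly 3 flag orbits. For the base flag $\Phi$ and a colour sequence with $\Phi^{c_1,\dots,c_m}$ in the orbit of $\Phi$, $\alpha_{c_1,\dots,c_m}$ is the unique automorphism mapping $\Phi$ to $\Phi^{c_1,\dots,c_m}$. The symmetry type graph $T(\mathcal{M})$ has as vertices the flag orbits, an edge of colour $c$ between distinct orbits $B,C$ iff some flag of $B$ is $c$-adjacent to a flag of $C$, and a semi-edge of colour $c$ at $B$ iff some flag of $B$ is $c$-adjacent to a flag of $B$. $\mathcal{M}$ is in class $3^{i,i+1}$ if the vertices of $T(\mathcal{M})$ can be named $v_1,v_2,v_3$ so that its only (non-semi) edges are an edge of colour $i$ joining $v_1,v_2$ and an edge of colour $i+1$ joining $v_2,v_3$; it is in class $3^i$ if its only edges are an edge of colour $i$ joining $v_1,v_2$ and two edges of colours $i-1$ and $i+1$ joining $v_2,v_3$. -}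

module Defs where

open import Data.Nat using (ℕ; zero; suc; _+_; _≤_; _<_; _<?_)
open import Data.Fin using (Fin; toℕ; fromℕ<)
open import Data.Integer using (ℤ; +_; -[1+_]; _-_; 1ℤ)
open import Data.List using (List; []; _∷_)
open import Data.List.Membership.Propositional using (_∈_)
open import Data.Maybe using (Maybe; just; nothing)
open import Data.Product using (Σ; ∃; ∃-syntax; _×_; _,_)
open import Data.Sum using (_⊎_)
open import Relation.Nullary using (¬_; yes; no)
open import Relation.Binary.PropositionalEquality using (_≡_; _≢_)
open import Function.Bundles using (_⇔_)

-- Maniplexes given by their flag graphs.
-- r c x is the c-adjacent flag x^c.  Colour classes are perfect
-- matchings (r c is a fixed-point-free involution), the edge colouring is
-- proper in a simple graph (x^i ≠ x^j for i ≠ j), and for |i-j| ≥ 2 the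
-- (i,j)-components are 4-cycles (x^{ij} = x^{ji}; distinctness of the
-- four flags follows from the other axioms).

-- Φ^{c1,...,cm}: first pass to c1, then c2, ...
module _ {Flag : Set} {n : ℕ} (r : Fin n → Flag → Flag) where
  applyWord : List (Fin n) → Flag → Flag
  applyWord [] x = x
  applyWord (c ∷ w) x = applyWord w (r c x)

FarApart : ∀ {n} → Fin n → Fin n → Set
FarApart i j = (toℕ i + 2 ≤ toℕ j) ⊎ (toℕ j + 2 ≤ toℕ i)

record Maniplex (n : ℕ) : Set₁ where
  field
    Flag      : Set
    r         : Fin n → Flag → Flag
    invol     : ∀ c x → r c (r c x) ≡ x
    fixfree   : ∀ c x → r c x ≢ x
    simple    : ∀ c d x → c ≢ d → r c x ≢ r d x
    commute   : ∀ c d x → FarApart c d → r c (r d x) ≡ r d (r c x)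
    connected : ∀ x y → ∃[ w ] y ≡ applyWord r w x

module _ {n : ℕ} (M : Maniplex n) where
  open Maniplex M

  record Aut : Set where
    field
      fun  : Flag → Flag
      inv  : Flag → Flag
      inv-left  : ∀ x → inv (fun x) ≡ x
      inv-right : ∀ x → fun (inv x) ≡ x
      preserves : ∀ c x → fun (r c x) ≡ r c (fun x)
  open Aut public

  _≈A_ : Aut → Aut → Set
  γ ≈A δ = ∀ x → fun γ x ≡ fun δ x

  idA : Aut
  idA = record { fun = λ x → x ; inv = λ x → x
               ; inv-left = λ _ → Relation.Binary.PropositionalEquality.refl
               ; inv-right = λ _ → Relation.Binary.PropositionalEquality.refl
               ; preserves = λ _ _ → Relation.Binary.PropositionalEquality.refl }

  data Generated (S : Aut → Set) : Aut → Set where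
    gen-id  : ∀ γ → γ ≈A idA → Generated S γ
    gen-mul : ∀ δ γ' γ → S δ → Generated S γ'
              → (∀ x → fun γ x ≡ fun δ (fun γ' x)) → Generated S γ
    gen-inv : ∀ δ γ' γ → S δ → Generated S γ'
              → (∀ x → fun γ x ≡ inv δ (fun γ' x)) → Generated S γ

  Orb : Flag → Flag → Set
  Orb x y = ∃[ γ ] fun γ x ≡ y

  -- symmetry type graph: an edge / semi-edge of colour c between the
  -- orbits of x and y
  HasEdge : Fin n → Flag → Flag → Set
  HasEdge c x y = ∃[ a ] (Orb x a × Orb y (r c a))

  ThreeOrbitReps : (Fin 3 → Flag) → Set
  ThreeOrbitReps v = (∀ a b → a ≢ b → ¬ Orb (v a) (v b))
                   × (∀ x → ∃[ a ] Orb (v a) x)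

  IsThreeOrbit : Set
  IsThreeOrbit = ∃[ v ] ThreeOrbitReps v

v1 v2 v3 : Fin 3
v1 = Data.Fin.zero
v2 = Data.Fin.suc Data.Fin.zero
v3 = Data.Fin.suc (Data.Fin.suc Data.Fin.zero)

-- allowed (non-semi) edges of T(M); vertices v1,v2,v3 are indices 0,1,2
Joins : Fin 3 → Fin 3 → Fin 3 → Fin 3 → Set
Joins a b p q = (a ≡ p × b ≡ q) ⊎ (a ≡ q × b ≡ p)

Allowed3ii1 : ∀ {n} → ℕ → Fin 3 → Fin 3 → Fin n → Set
Allowed3ii1 i a b c =
    (toℕ c ≡ i × Joins a b v1 (v2))
  ⊎ (toℕ c ≡ suc i × Joins a b (v2) (v3))

Allowed3i : ∀ {n} → ℕ → Fin 3 → Fin 3 → Fin n → Set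
Allowed3i i a b c =
    (toℕ c ≡ i × Joins a b v1 (v2))
  ⊎ (suc (toℕ c) ≡ i × Joins a b (v2) (v3))
  ⊎ (toℕ c ≡ suc i × Joins a b (v2) (v3))

module _ {n : ℕ} (M : Maniplex n) where
  open Maniplex M

  ClassWith : (Fin 3 → Fin 3 → Fin n → Set) → Set
  ClassWith Allowed = ∃[ v ] (ThreeOrbitReps M v
      × (∀ a b → a ≢ b → ∀ c → HasEdge M c (v a) (v b) ⇔ Allowed a b c))

  Class3ii1 : ℕ → Set
  Class3ii1 i = ClassWith (Allowed3ii1 i)

  Class3i : ℕ → Set
  Class3i i = ClassWith (Allowed3i i)

  BaseFlag : ℕ → Flag → Set
  BaseFlag i Φ = ∀ (j : Fin n) → toℕ j ≢ i → Orb M Φ (r j Φ)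

  toColour : ℤ → Maybe (Fin n)
  toColour (+ k) with k <? n
  ... | yes p = just (fromℕ< p)
  ... | no _  = nothing
  toColour -[1+ _ ] = nothing

  toColours : List ℤ → Maybe (List (Fin n))
  toColours [] = just []
  toColours (z ∷ zs) with toColour z | toColours zs
  ... | just c | just cs = just (c ∷ cs)
  ... | _      | _       = nothing

  -- the flag Φ^{w}, or Φ itself if some index of w is out of range
  -- (α_w is then the identity)
  target : List ℤ → Flag → Flag
  target w Φ with toColours w
  ... | just cs = applyWord r cs Φ
  ... | nothing = Φ

  Targets : ℕ → List (List ℤ) → Flag → Flag → Set
  Targets i W Φ x = (∃[ j ] (toℕ j ≢ i × x ≡ r j Φ))
                  ⊎ (∃[ w ] (w ∈ W × x ≡ target w Φ))

  -- α_w is the unique automorphism with Φ ↦ Φ^w; the conclusion asserts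
  -- that each α exists and that they generate Aut(M)
  IsGeneratingSet : ℕ → List (List ℤ) → Flag → Set
  IsGeneratingSet i W Φ =
      (∀ x → Targets i W Φ x → Orb M Φ x)
    × (∀ γ → Generated M (λ δ → Targets i W Φ (fun δ Φ)) γ)

words3i : ℕ → List (List ℤ)
words3i i = (+ i ∷ (+ i - 1ℤ) ∷ + suc i ∷ + i ∷ [])
          ∷ (+ i ∷ + suc i ∷ + suc (suc i) ∷ + suc i ∷ + i ∷ [])
          ∷ (+ i ∷ + suc i ∷ + i ∷ + suc i ∷ + i ∷ [])
          ∷ []

words3ii1 : ℕ → List (List ℤ)
words3ii1 i = (+ i ∷ (+ i - 1ℤ) ∷ + i ∷ [])
            ∷ (+ i ∷ + suc i ∷ + suc (suc i) ∷ + suc i ∷ + i ∷ [])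
            ∷ (+ i ∷ + suc i ∷ + i ∷ + suc i ∷ + i ∷ [])
            ∷ []

-- Take Φ, Φ^i and Φ^{i,i+1} as representatives of the three flag orbits.  An automorphism γ
-- is generated as soon as every neighbour of every representative is the image of some
-- representative under a generated automorphism: following a path from Φ to γ(Φ) then yields
-- a generated β with β(Φ) = γ(Φ) (the representative reached must be Φ, as the orbits are
-- distinct), so β = γ by connectivity.  For colours far from i and i+1, α_c commutes past the
-- path to the representative; colours i and i+1 along the path need only the identity; each
-- remaining neighbour is reached by one of the extra α_w, whose word w is a walk through
-- Φ^i and Φ^{i,i+1} that the shape of T(M) forces back into the orbit of Φ.
module Submission where

open import Defs
open import Data.Nat using (ℕ; zero; suc; _+_; _≤_; _<_; _<?_; z≤n; s≤s)
open import Data.Nat.Properties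
  using (1+n≢n; m≢1+n+m; m+1+n≰m; ≤-reflexive; ≤-trans; +-comm; m≤n⇒m≤1+n; n≤1+n; n<1+n; <-trans)
open import Data.Fin using (Fin; zero; suc; toℕ; fromℕ<)
open import Data.Fin.Properties using (toℕ-injective; toℕ-fromℕ<; toℕ<n) renaming (_≟_ to _≟ᶠ_)
open import Data.Integer using (ℤ; +_; _-_; 1ℤ)
open import Data.List using (List; []; _∷_)
open import Data.List.Membership.Propositional using (_∈_)
open import Data.List.Relation.Unary.Any using (Any; here; there)
open import Data.List.Relation.Binary.Pointwise using (Pointwise; []; _∷_)
open import Data.Maybe using (just; nothing)
open import Data.Product using (∃-syntax; _×_; _,_; proj₁; proj₂)
open import Data.Sum using (_⊎_; inj₁; inj₂)
open import Data.Empty using (⊥-elim)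
open import Relation.Nullary using (¬_; Dec; yes; no)
open import Relation.Binary.PropositionalEquality
open import Function.Bundles using (Equivalence)

module Automorphisms {n : ℕ} (M : Maniplex n) where
  open Maniplex M

  infixl 9 _^_
  _^_ : Flag → Fin n → Flag
  x ^ c = r c x

  ^-cancel₂ : ∀ x a b → x ^ a ^ b ^ b ^ a ≡ x
  ^-cancel₂ x a b = trans (cong (_^ a) (invol b (x ^ a))) (invol a x)

  infixr 9 _∘ᴬ_
  _∘ᴬ_ : Aut M → Aut M → Aut M
  γ ∘ᴬ δ = record
    { fun       = λ x → fun γ (fun δ x)
    ; inv       = λ x → inv δ (inv γ x)
    ; inv-left  = λ x → trans (cong (inv δ) (inv-left γ (fun δ x))) (inv-left δ x)
    ; inv-right = λ x → trans (cong (fun γ) (inv-right δ (inv γ x))) (inv-right γ x)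
    ; preserves = λ c x → trans (cong (fun γ) (preserves δ c x)) (preserves γ c (fun δ x))
    }

  _⁻¹ᴬ : Aut M → Aut M
  γ ⁻¹ᴬ = record
    { fun       = inv γ
    ; inv       = fun γ
    ; inv-left  = inv-right γ
    ; inv-right = inv-left γ
    ; preserves = λ c x → begin
        inv γ (x ^ c)                   ≡⟨ cong (λ y → inv γ (y ^ c)) (inv-right γ x) ⟨
        inv γ (fun γ (inv γ x) ^ c)     ≡⟨ cong (inv γ) (preserves γ c (inv γ x)) ⟨
        inv γ (fun γ (inv γ x ^ c))     ≡⟨ inv-left γ (inv γ x ^ c) ⟩
        inv γ x ^ c                     ∎
    }
    where open ≡-Reasoning

  fun-applyWord : ∀ (γ : Aut M) w x → fun γ (applyWord r w x) ≡ applyWord r w (fun γ x)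
  fun-applyWord γ []      x = refl
  fun-applyWord γ (c ∷ w) x = trans (fun-applyWord γ w (x ^ c)) (cong (applyWord r w) (preserves γ c x))

  fun-unique : ∀ (γ δ : Aut M) {x} → fun γ x ≡ fun δ x → ∀ y → fun γ y ≡ fun δ y
  fun-unique γ δ {x} γx≡δx y with connected x y
  ... | w , refl = begin
    fun γ (applyWord r w x)   ≡⟨ fun-applyWord γ w x ⟩
    applyWord r w (fun γ x)   ≡⟨ cong (applyWord r w) γx≡δx ⟩
    applyWord r w (fun δ x)   ≡⟨ fun-applyWord δ w x ⟨
    fun δ (applyWord r w x)   ∎
    where open ≡-Reasoning

  Orb-refl : ∀ x → Orb M x x
  Orb-refl x = idA M , refl

  Orb-sym : ∀ {x y} → Orb M x y → Orb M y x
  Orb-sym (γ , refl) = γ ⁻¹ᴬ , inv-left γ _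

  Orb-trans : ∀ {x y z} → Orb M x y → Orb M y z → Orb M x z
  Orb-trans (γ , refl) (δ , refl) = δ ∘ᴬ γ , refl

  Orb-^ : ∀ c {x y} → Orb M x y → Orb M (x ^ c) (y ^ c)
  Orb-^ c (γ , refl) = γ , preserves γ c _

  module Generating (S : Aut M → Set) where

    Generated-resp : ∀ {γ δ} → Generated M S γ → (∀ x → fun γ x ≡ fun δ x) → Generated M S δ
    Generated-resp (gen-id _ e)          γ≈δ = gen-id _ (λ x → trans (sym (γ≈δ x)) (e x))
    Generated-resp (gen-mul d γ' _ s g e) γ≈δ = gen-mul d γ' _ s g (λ x → trans (sym (γ≈δ x)) (e x))
    Generated-resp (gen-inv d γ' _ s g e) γ≈δ = gen-inv d γ' _ s g (λ x → trans (sym (γ≈δ x)) (e x))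

    Generated-∘ : ∀ {γ δ} → Generated M S γ → Generated M S δ → Generated M S (γ ∘ᴬ δ)
    Generated-∘ {δ = δ} (gen-id _ e)          gδ = Generated-resp gδ (λ x → sym (e (fun δ x)))
    Generated-∘ {δ = δ} (gen-mul d γ' _ s g e) gδ = gen-mul d (γ' ∘ᴬ δ) _ s (Generated-∘ g gδ) (λ x → e (fun δ x))
    Generated-∘ {δ = δ} (gen-inv d γ' _ s g e) gδ = gen-inv d (γ' ∘ᴬ δ) _ s (Generated-∘ g gδ) (λ x → e (fun δ x))

    Generated-id : Generated M S (idA M)
    Generated-id = gen-id _ (λ _ → refl)

    Generated-gen : ∀ {δ} → S δ → Generated M S δ
    Generated-gen s = gen-mul _ (idA M) _ s Generated-id (λ _ → refl)

    Generated-gen⁻¹ : ∀ {δ} → S δ → Generated M S (δ ⁻¹ᴬ)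
    Generated-gen⁻¹ s = gen-inv _ (idA M) _ s Generated-id (λ _ → refl)

    module _ {m : ℕ} (R : Fin (suc m) → Flag) where

      Covered : Flag → Set
      Covered y = ∃[ k ] ∃[ β ] Generated M S β × fun β (R k) ≡ y

      module _ (moves : ∀ k c → Covered (R k ^ c)) where

        Covered-^ : ∀ {y} c → Covered y → Covered (y ^ c)
        Covered-^ {y} c (k , β , gβ , βRk≡y) with moves k c
        ... | k' , δ , gδ , δRk'≡Rk^c = k' , β ∘ᴬ δ , Generated-∘ gβ gδ , (begin
          fun β (fun δ (R k'))   ≡⟨ cong (fun β) δRk'≡Rk^c ⟩
          fun β (R k ^ c)        ≡⟨ preserves β c (R k) ⟩
          fun β (R k) ^ c        ≡⟨ cong (_^ c) βRk≡y ⟩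
          y ^ c                  ∎)
          where open ≡-Reasoning

        Covered-applyWord : ∀ w {y} → Covered y → Covered (applyWord r w y)
        Covered-applyWord []      cov = cov
        Covered-applyWord (c ∷ w) cov = Covered-applyWord w (Covered-^ c cov)

        generates : (∀ a b → a ≢ b → ¬ Orb M (R a) (R b)) → ∀ γ → Generated M S γ
        generates distinct γ with connected (R zero) (fun γ (R zero))
        ... | w , γR₀≡ with Covered-applyWord w (zero , idA M , Generated-id , refl)
        ... | k , β , gβ , βRk≡ with k ≟ᶠ zero
        ... | yes refl = Generated-resp gβ (fun-unique β γ (trans βRk≡ (sym γR₀≡)))
        ... | no k≢0   = ⊥-elim (distinct k zero k≢0
                           (Orb-trans (β , trans βRk≡ (sym γR₀≡)) (Orb-sym (γ , refl))))

module ColourWords {n : ℕ} (M : Maniplex n) where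
  open Maniplex M

  toColour-+ : ∀ (c : Fin n) {k} → toℕ c ≡ k → toColour M (+ k) ≡ just c
  toColour-+ c {k} e with k <? n
  ... | yes k<n = cong just (toℕ-injective (trans (toℕ-fromℕ< k<n) (sym e)))
  ... | no  k≮n = ⊥-elim (k≮n (subst (_< n) e (toℕ<n c)))

  toColour-pred : ∀ (c : Fin n) {k} → suc (toℕ c) ≡ k → toColour M (+ k - 1ℤ) ≡ just c
  toColour-pred c refl = toColour-+ c refl

  toColour-≥ : ∀ {k} → ¬ k < n → toColour M (+ k) ≡ nothing
  toColour-≥ {k} k≮n with k <? n
  ... | yes k<n = ⊥-elim (k≮n k<n)
  ... | no  _   = refl

  toColours-just : ∀ {zs cs} → Pointwise (λ z c → toColour M z ≡ just c) zs cs → toColours M zs ≡ just cs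
  toColours-just []       = refl
  toColours-just (e ∷ es) rewrite e | toColours-just es = refl

  toColours-nothing : ∀ {zs} → Any (λ z → toColour M z ≡ nothing) zs → toColours M zs ≡ nothing
  toColours-nothing (here e) rewrite e = refl
  toColours-nothing {z ∷ _} (there p) with toColour M z
  ... | just _  rewrite toColours-nothing p = refl
  ... | nothing = refl

  target-inRange : ∀ {w cs} Φ → Pointwise (λ z c → toColour M z ≡ just c) w cs →
                   target M w Φ ≡ applyWord r cs Φ
  target-inRange Φ p rewrite toColours-just p = refl

  target-outOfRange : ∀ {w} Φ → Any (λ z → toColour M z ≡ nothing) w → target M w Φ ≡ Φ
  target-outOfRange Φ p rewrite toColours-nothing p = refl

predecessor : ∀ {n} i → i < n → i ≡ 0 ⊎ ∃[ c ] suc (toℕ {n} c) ≡ i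
predecessor zero    _   = inj₁ refl
predecessor (suc m) m<n = inj₂ (fromℕ< (<-trans (n<1+n m) m<n) , cong suc (toℕ-fromℕ< _))

FarApart-≢ : ∀ {n} {a b : Fin n} → FarApart a b → a ≢ b
FarApart-≢ {b = b} (inj₁ a+2≤b) refl = m+1+n≰m (toℕ b) a+2≤b
FarApart-≢ {a = a} (inj₂ b+2≤a) refl = m+1+n≰m (toℕ a) b+2≤a

data Offset (a i : ℕ) : Set where
  far-below  : a + 2 ≤ i → Offset a i
  just-below : suc a ≡ i → Offset a i
  equal      : a ≡ i → Offset a i
  just-above : a ≡ suc i → Offset a i
  two-above  : a ≡ suc (suc i) → Offset a i
  far-above  : suc i + 2 ≤ a → Offset a i

offset : ∀ a i → Offset a i
offset zero                zero          = equal refl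
offset zero                (suc zero)    = just-below refl
offset zero                (suc (suc i)) = far-below (s≤s (s≤s z≤n))
offset (suc zero)          zero          = just-above refl
offset (suc (suc zero))    zero          = two-above refl
offset (suc (suc (suc a))) zero          = far-above (s≤s (s≤s (s≤s z≤n)))
offset (suc a)             (suc i)       with offset a i
... | far-below  q = far-below (s≤s q)
... | just-below e = just-below (cong suc e)
... | equal      e = equal (cong suc e)
... | just-above e = just-above (cong suc e)
... | two-above  e = two-above (cong suc e)
... | far-above  q = far-above (s≤s q)

module TypeGraph {n : ℕ} (M : Maniplex n) {Allowed : Fin 3 → Fin 3 → Fin n → Set}
                 (class : ClassWith M Allowed) where
  open Maniplex M
  open Automorphisms M

  v : Fin 3 → Flag
  v = proj₁ class

  reps : ThreeOrbitReps M v
  reps = proj₁ (proj₂ class)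

  orbit-step : ∀ {a b c x} → Orb M (v a) x → a ≢ b → Allowed a b c → Orb M (v b) (x ^ c)
  orbit-step {a} {b} {c} va∼x a≢b edge with Equivalence.from (proj₂ (proj₂ class) a b a≢b c) edge
  ... | y , va∼y , vb∼y^c = Orb-trans vb∼y^c (Orb-^ c (Orb-trans (Orb-sym va∼y) va∼x))

  orbit-semi-step : ∀ {a c x} → Orb M (v a) x → (∀ b → a ≢ b → ¬ Allowed a b c) → Orb M (v a) (x ^ c)
  orbit-semi-step {a} {c} {x} va∼x no-edge with proj₂ reps (x ^ c)
  ... | b , vb∼x^c with a ≟ᶠ b
  ... | yes refl = vb∼x^c
  ... | no  a≢b  = ⊥-elim (no-edge b a≢b
                     (Equivalence.to (proj₂ (proj₂ class) a b a≢b c) (x , va∼x , vb∼x^c)))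

module AdjacentColours {n : ℕ} (i : ℕ) (i+1<n : suc i < n) where

  cᵢ cᵢ₊₁ : Fin n
  cᵢ   = fromℕ< (<-trans (n<1+n i) i+1<n)
  cᵢ₊₁ = fromℕ< i+1<n

  toℕ-cᵢ : toℕ cᵢ ≡ i
  toℕ-cᵢ = toℕ-fromℕ< _

  toℕ-cᵢ₊₁ : toℕ cᵢ₊₁ ≡ suc i
  toℕ-cᵢ₊₁ = toℕ-fromℕ< i+1<n

module Generation {n : ℕ} (M : Maniplex n) {Allowed : Fin 3 → Fin 3 → Fin n → Set}
  (class : ClassWith M Allowed) (i : ℕ) (cᵢ cᵢ₊₁ : Fin n)
  (toℕ-cᵢ : toℕ cᵢ ≡ i) (toℕ-cᵢ₊₁ : toℕ cᵢ₊₁ ≡ suc i)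
  (i-joins-v1-v2 : Allowed v1 v2 cᵢ) (i-joins-v2-v1 : Allowed v2 v1 cᵢ)
  (i+1-joins-v2-v3 : Allowed v2 v3 cᵢ₊₁) (i+1-joins-v3-v2 : Allowed v3 v2 cᵢ₊₁)
  (no-i-at-v3 : ∀ b → v3 ≢ b → ¬ Allowed v3 b cᵢ)
  (no-i+2-at-v3 : ∀ c → toℕ c ≡ suc (suc i) → ∀ b → v3 ≢ b → ¬ Allowed v3 b c)
  (Φ : Maniplex.Flag M) (base : BaseFlag M i Φ) (W₁ : List ℤ)
  where
  open Maniplex M
  open Automorphisms M
  open ColourWords M
  open TypeGraph M class

  W₂ W₃ : List ℤ
  W₂ = + i ∷ + suc i ∷ + suc (suc i) ∷ + suc i ∷ + i ∷ []
  W₃ = + i ∷ + suc i ∷ + i ∷ + suc i ∷ + i ∷ []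

  Words : List (List ℤ)
  Words = W₁ ∷ W₂ ∷ W₃ ∷ []

  S : Aut M → Set
  S δ = Targets M i Words Φ (fun δ Φ)

  open Generating S public

  c≢cᵢ⇒toℕ≢i : ∀ {c} → c ≢ cᵢ → toℕ c ≢ i
  c≢cᵢ⇒toℕ≢i c≢cᵢ e = c≢cᵢ (toℕ-injective (trans e (sym toℕ-cᵢ)))

  Φ∼Φ^i+1 : Orb M Φ (Φ ^ cᵢ₊₁)
  Φ∼Φ^i+1 = base cᵢ₊₁ (λ e → 1+n≢n (trans (sym toℕ-cᵢ₊₁) e))

  -- Colour i+1 is a semi-edge at the orbit of Φ but joins the orbits of v2 and v3.
  v1∼Φ : Orb M (v v1) Φ
  v1∼Φ with proj₂ reps Φ
  ... | zero , v1∼Φ = v1∼Φ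
  ... | suc zero , v2∼Φ = ⊥-elim (proj₁ reps v2 v3 (λ ())
          (Orb-trans v2∼Φ (Orb-trans Φ∼Φ^i+1 (Orb-sym (orbit-step v2∼Φ (λ ()) i+1-joins-v2-v3)))))
  ... | suc (suc zero) , v3∼Φ = ⊥-elim (proj₁ reps v3 v2 (λ ())
          (Orb-trans v3∼Φ (Orb-trans Φ∼Φ^i+1 (Orb-sym (orbit-step v3∼Φ (λ ()) i+1-joins-v3-v2)))))

  v2∼Φ^i : Orb M (v v2) (Φ ^ cᵢ)
  v2∼Φ^i = orbit-step v1∼Φ (λ ()) i-joins-v1-v2

  v3∼Φ^i^i+1 : Orb M (v v3) (Φ ^ cᵢ ^ cᵢ₊₁)
  v3∼Φ^i^i+1 = orbit-step v2∼Φ^i (λ ()) i+1-joins-v2-v3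

  Φ∼from-v2 : ∀ {x} → Orb M (v v2) x → Orb M Φ (x ^ cᵢ)
  Φ∼from-v2 v2∼x = Orb-trans (Orb-sym v1∼Φ) (orbit-step v2∼x (λ ()) i-joins-v2-v1)

  Φ∼from-v3 : ∀ {x} → Orb M (v v3) x → Orb M Φ (x ^ cᵢ₊₁ ^ cᵢ)
  Φ∼from-v3 v3∼x = Φ∼from-v2 (orbit-step v3∼x (λ ()) i+1-joins-v3-v2)

  path : Fin 3 → List (Fin n)
  path zero             = []
  path (suc zero)       = cᵢ ∷ []
  path (suc (suc zero)) = cᵢ ∷ cᵢ₊₁ ∷ []

  R : Fin 3 → Flag
  R k = applyWord r (path k) Φ

  v∼R : ∀ k → Orb M (v k) (R k)
  v∼R zero             = v1∼Φ
  v∼R (suc zero)       = v2∼Φ^i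
  v∼R (suc (suc zero)) = v3∼Φ^i^i+1

  R-distinct : ∀ a b → a ≢ b → ¬ Orb M (R a) (R b)
  R-distinct a b a≢b Ra∼Rb = proj₁ reps a b a≢b (Orb-trans (v∼R a) (Orb-trans Ra∼Rb (Orb-sym (v∼R b))))

  Generator : Flag → Set
  Generator x = ∃[ δ ] S δ × fun δ Φ ≡ x

  α-colour : ∀ {c} → toℕ c ≢ i → Generator (Φ ^ c)
  α-colour {c} c≢i with base c c≢i
  ... | δ , e = δ , inj₁ (c , c≢i , e) , e

  α-word : ∀ {w x} → w ∈ Words → target M w Φ ≡ x → Orb M Φ x → Generator x
  α-word w∈ target≡x (δ , e) = δ , inj₂ (_ , w∈ , trans e (sym target≡x)) , e

  covered-id : ∀ {y} k → R k ≡ y → Covered R y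
  covered-id k e = k , idA M , Generated-id , e

  covered-by : ∀ {x y} → Generator x → ∀ k → applyWord r (path k) x ≡ y → Covered R y
  covered-by {x} {y} (δ , s , δΦ≡x) k e = k , δ , Generated-gen s , (begin
    fun δ (applyWord r (path k) Φ)   ≡⟨ fun-applyWord δ (path k) Φ ⟩
    applyWord r (path k) (fun δ Φ)   ≡⟨ cong (applyWord r (path k)) δΦ≡x ⟩
    applyWord r (path k) x           ≡⟨ e ⟩
    y                                ∎)
    where open ≡-Reasoning

  covered-by⁻¹ : ∀ {x} → Generator x → ∀ k w → applyWord r w x ≡ R k → Covered R (applyWord r w Φ)
  covered-by⁻¹ {x} (δ , s , δΦ≡x) k w e = k , δ ⁻¹ᴬ , Generated-gen⁻¹ {δ} s , (begin
    inv δ (R k)                       ≡⟨ cong (inv δ) e ⟨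
    inv δ (applyWord r w x)           ≡⟨ cong (λ y → inv δ (applyWord r w y)) δΦ≡x ⟨
    inv δ (applyWord r w (fun δ Φ))   ≡⟨ cong (inv δ) (fun-applyWord δ w Φ) ⟨
    inv δ (fun δ (applyWord r w Φ))   ≡⟨ inv-left δ _ ⟩
    applyWord r w Φ                   ∎)
    where open ≡-Reasoning

  data Position (c : Fin n) : Set where
    at-i   : c ≡ cᵢ → Position c
    at-i+1 : c ≡ cᵢ₊₁ → Position c
    at-i-1 : suc (toℕ c) ≡ i → Position c
    at-i+2 : toℕ c ≡ suc (suc i) → FarApart cᵢ c → Position c
    far    : FarApart cᵢ c → FarApart cᵢ₊₁ c → Position c

  position : ∀ c → Position c
  position c with offset (toℕ c) i
  ... | far-below  q = far (inj₂ (subst (toℕ c + 2 ≤_) (sym toℕ-cᵢ) q))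
                           (inj₂ (subst (toℕ c + 2 ≤_) (sym toℕ-cᵢ₊₁) (m≤n⇒m≤1+n q)))
  ... | just-below e = at-i-1 e
  ... | equal      e = at-i (toℕ-injective (trans e (sym toℕ-cᵢ)))
  ... | just-above e = at-i+1 (toℕ-injective (trans e (sym toℕ-cᵢ₊₁)))
  ... | two-above  e = at-i+2 e (inj₁ (subst₂ (λ a b → a + 2 ≤ b) (sym toℕ-cᵢ) (sym e) (≤-reflexive (+-comm i 2))))
  ... | far-above  q = far (inj₁ (subst (λ a → a + 2 ≤ toℕ c) (sym toℕ-cᵢ) (≤-trans (n≤1+n (i + 2)) q)))
                           (inj₁ (subst (λ a → a + 2 ≤ toℕ c) (sym toℕ-cᵢ₊₁) q))

  far⇒toℕ≢i : ∀ {c} → FarApart cᵢ c → toℕ c ≢ i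
  far⇒toℕ≢i f = c≢cᵢ⇒toℕ≢i (λ e → FarApart-≢ f (sym e))

  i-1-far-from-i+1 : ∀ {c} → suc (toℕ c) ≡ i → FarApart cᵢ₊₁ c
  i-1-far-from-i+1 {c} e =
    inj₂ (subst (toℕ c + 2 ≤_) (trans (cong suc e) (sym toℕ-cᵢ₊₁)) (≤-reflexive (+-comm (toℕ c) 2)))

  toColour-i : toColour M (+ i) ≡ just cᵢ
  toColour-i = toColour-+ cᵢ toℕ-cᵢ

  toColour-i+1 : toColour M (+ suc i) ≡ just cᵢ₊₁
  toColour-i+1 = toColour-+ cᵢ₊₁ toℕ-cᵢ₊₁

  target-W₃ : target M W₃ Φ ≡ Φ ^ cᵢ ^ cᵢ₊₁ ^ cᵢ ^ cᵢ₊₁ ^ cᵢ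
  target-W₃ = target-inRange Φ (toColour-i ∷ toColour-i+1 ∷ toColour-i ∷ toColour-i+1 ∷ toColour-i ∷ [])

  Φ∼Φ^W₃ : Orb M Φ (Φ ^ cᵢ ^ cᵢ₊₁ ^ cᵢ ^ cᵢ₊₁ ^ cᵢ)
  Φ∼Φ^W₃ = Φ∼from-v3 (orbit-semi-step v3∼Φ^i^i+1 no-i-at-v3)

  target-W₂ : ∀ {c} → toℕ c ≡ suc (suc i) → target M W₂ Φ ≡ Φ ^ cᵢ ^ cᵢ₊₁ ^ c ^ cᵢ₊₁ ^ cᵢ
  target-W₂ {c} e =
    target-inRange Φ (toColour-i ∷ toColour-i+1 ∷ toColour-+ c e ∷ toColour-i+1 ∷ toColour-i ∷ [])

  Φ∼Φ^W₂ : ∀ {c} → toℕ c ≡ suc (suc i) → Orb M Φ (Φ ^ cᵢ ^ cᵢ₊₁ ^ c ^ cᵢ₊₁ ^ cᵢ)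
  Φ∼Φ^W₂ {c} e = Φ∼from-v3 (orbit-semi-step v3∼Φ^i^i+1 (no-i+2-at-v3 c e))

  W₂-orbit : Orb M Φ (target M W₂ Φ)
  W₂-orbit = by-range (suc (suc i) <? n)
    where
    by-range : Dec (suc (suc i) < n) → Orb M Φ (target M W₂ Φ)
    by-range (yes i+2<n) = subst (Orb M Φ) (sym (target-W₂ e)) (Φ∼Φ^W₂ e)
      where e = toℕ-fromℕ< i+2<n
    by-range (no i+2≮n)  = subst (Orb M Φ) (sym (target-outOfRange {W₂} Φ (there (there (here (toColour-≥ i+2≮n))))))
                             (Orb-refl Φ)

  moves-v1 : ∀ c → Covered R (R v1 ^ c)
  moves-v1 c with c ≟ᶠ cᵢ
  ... | yes refl = covered-id v2 refl
  ... | no  c≢cᵢ = covered-by (α-colour (c≢cᵢ⇒toℕ≢i c≢cᵢ)) v1 refl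

  moves-v2 : (∀ c → suc (toℕ c) ≡ i → Covered R (R v2 ^ c)) → ∀ c → Covered R (R v2 ^ c)
  moves-v2 moves-i-1 c with position c
  ... | at-i refl   = covered-id v1 (sym (invol cᵢ Φ))
  ... | at-i+1 refl = covered-id v3 refl
  ... | at-i-1 e    = moves-i-1 c e
  ... | at-i+2 _ f  = covered-by (α-colour (far⇒toℕ≢i f)) v2 (commute cᵢ c Φ f)
  ... | far f _     = covered-by (α-colour (far⇒toℕ≢i f)) v2 (commute cᵢ c Φ f)

  moves-v3 : (∀ c → suc (toℕ c) ≡ i → Covered R (R v3 ^ c)) → ∀ c → Covered R (R v3 ^ c)
  moves-v3 moves-i-1 c with position c
  ... | at-i refl   = covered-by (α-word (there (there (here refl))) target-W₃ Φ∼Φ^W₃) v3 (^-cancel₂ _ cᵢ₊₁ cᵢ)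
  ... | at-i+1 refl = covered-id v2 (sym (invol cᵢ₊₁ (Φ ^ cᵢ)))
  ... | at-i-1 e    = moves-i-1 c e
  ... | at-i+2 e _  = covered-by (α-word (there (here refl)) (target-W₂ e) (Φ∼Φ^W₂ e)) v3 (^-cancel₂ _ cᵢ₊₁ cᵢ)
  ... | far f f′    = covered-by (α-colour (far⇒toℕ≢i f)) v3
                        (trans (cong (_^ cᵢ₊₁) (commute cᵢ c Φ f)) (commute cᵢ₊₁ c (Φ ^ cᵢ) f′))

  generating : Orb M Φ (target M W₁ Φ) →
               (∀ c → suc (toℕ c) ≡ i → Covered R (R v2 ^ c) × Covered R (R v3 ^ c)) →
               IsGeneratingSet M i Words Φ
  generating W₁-orbit moves-i-1 = in-orbit , generates R moves R-distinct
    where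
    in-orbit : ∀ x → Targets M i Words Φ x → Orb M Φ x
    in-orbit x (inj₁ (j , j≢i , refl))                  = base j j≢i
    in-orbit x (inj₂ (_ , here refl , refl))             = W₁-orbit
    in-orbit x (inj₂ (_ , there (here refl) , refl))     = W₂-orbit
    in-orbit x (inj₂ (_ , there (there (here refl)) , refl)) = subst (Orb M Φ) (sym target-W₃) Φ∼Φ^W₃

    moves : ∀ k c → Covered R (R k ^ c)
    moves zero             = moves-v1
    moves (suc zero)       = moves-v2 (λ c e → proj₁ (moves-i-1 c e))
    moves (suc (suc zero)) = moves-v3 (λ c e → proj₂ (moves-i-1 c e))

module Class3ii1Generation {n : ℕ} (M : Maniplex n) (i : ℕ) (i+1<n : suc i < n)
  (class : Class3ii1 M i) (Φ : Maniplex.Flag M) (base : BaseFlag M i Φ) where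
  open Maniplex M
  open Automorphisms M
  open ColourWords M
  open TypeGraph M class
  open AdjacentColours {n} i i+1<n

  no-i-at-v3 : ∀ b → v3 ≢ b → ¬ Allowed3ii1 i v3 b cᵢ
  no-i-at-v3 _ _ (inj₁ (_ , inj₁ (() , _)))
  no-i-at-v3 _ _ (inj₁ (_ , inj₂ (() , _)))
  no-i-at-v3 _ _ (inj₂ (e , _)) = 1+n≢n (trans (sym e) toℕ-cᵢ)

  no-i+2-at-v3 : ∀ (c : Fin n) → toℕ c ≡ suc (suc i) → ∀ b → v3 ≢ b → ¬ Allowed3ii1 i v3 b c
  no-i+2-at-v3 _ e _ _ (inj₁ (e′ , _)) = m≢1+n+m i (trans (sym e′) e)
  no-i+2-at-v3 _ e _ _ (inj₂ (e′ , _)) = 1+n≢n (trans (sym e) e′)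

  no-i-1-at-v2 : ∀ (c : Fin n) → suc (toℕ c) ≡ i → ∀ b → v2 ≢ b → ¬ Allowed3ii1 i v2 b c
  no-i-1-at-v2 c e _ _ (inj₁ (e′ , _)) = 1+n≢n (trans e (sym e′))
  no-i-1-at-v2 c e _ _ (inj₂ (e′ , _)) = m≢1+n+m (toℕ c) (trans e′ (cong suc (sym e)))

  W₁ : List ℤ
  W₁ = + i ∷ (+ i - 1ℤ) ∷ + i ∷ []

  open Generation {n} M class i cᵢ cᵢ₊₁ toℕ-cᵢ toℕ-cᵢ₊₁
    (inj₁ (toℕ-cᵢ , inj₁ (refl , refl))) (inj₁ (toℕ-cᵢ , inj₂ (refl , refl)))
    (inj₂ (toℕ-cᵢ₊₁ , inj₁ (refl , refl))) (inj₂ (toℕ-cᵢ₊₁ , inj₂ (refl , refl)))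
    no-i-at-v3 no-i+2-at-v3 Φ base W₁

  module _ {c : Fin n} (e : suc (toℕ c) ≡ i) where

    target-W₁ : target M W₁ Φ ≡ Φ ^ cᵢ ^ c ^ cᵢ
    target-W₁ = target-inRange {W₁} Φ (toColour-i ∷ toColour-pred c e ∷ toColour-i ∷ [])

    Φ∼Φ^W₁ : Orb M Φ (Φ ^ cᵢ ^ c ^ cᵢ)
    Φ∼Φ^W₁ = Φ∼from-v2 (orbit-semi-step v2∼Φ^i (no-i-1-at-v2 c e))

    moves-i-1 : Covered R (R v2 ^ c) × Covered R (R v3 ^ c)
    moves-i-1 =
        covered-by α-W₁ v2 (invol cᵢ _)
      , covered-by α-W₁ v3 (trans (cong (_^ cᵢ₊₁) (invol cᵢ _)) (commute cᵢ₊₁ c _ (i-1-far-from-i+1 e)))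
      where α-W₁ = α-word (here refl) target-W₁ Φ∼Φ^W₁

  W₁-orbit : Orb M Φ (target M W₁ Φ)
  W₁-orbit with predecessor i (<-trans (n<1+n i) i+1<n)
  ... | inj₁ i≡0    = subst (Orb M Φ) (sym (target-outOfRange {W₁} Φ (there (here i-1∉colours)))) (Orb-refl Φ)
    where i-1∉colours = subst (λ k → toColour M (+ k - 1ℤ) ≡ nothing) (sym i≡0) refl
  ... | inj₂ (_ , e) = subst (Orb M Φ) (sym (target-W₁ e)) (Φ∼Φ^W₁ e)

  generating-set : IsGeneratingSet M i (words3ii1 i) Φ
  generating-set = generating W₁-orbit (λ _ → moves-i-1)

module Class3iGeneration {n : ℕ} (M : Maniplex n) (i : ℕ) (i+1<n : suc i < n)
  (cᵢ₋₁ : Fin n) (toℕ-cᵢ₋₁ : suc (toℕ cᵢ₋₁) ≡ i)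
  (class : Class3i M i) (Φ : Maniplex.Flag M) (base : BaseFlag M i Φ) where
  open Maniplex M
  open Automorphisms M
  open ColourWords M
  open TypeGraph M class
  open AdjacentColours {n} i i+1<n

  no-i-at-v3 : ∀ b → v3 ≢ b → ¬ Allowed3i i v3 b cᵢ
  no-i-at-v3 _ _ (inj₁ (_ , inj₁ (() , _)))
  no-i-at-v3 _ _ (inj₁ (_ , inj₂ (() , _)))
  no-i-at-v3 _ _ (inj₂ (inj₁ (e , _))) = 1+n≢n (trans (cong suc (sym toℕ-cᵢ)) e)
  no-i-at-v3 _ _ (inj₂ (inj₂ (e , _))) = 1+n≢n (trans (sym e) toℕ-cᵢ)

  no-i+2-at-v3 : ∀ (c : Fin n) → toℕ c ≡ suc (suc i) → ∀ b → v3 ≢ b → ¬ Allowed3i i v3 b c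
  no-i+2-at-v3 _ e _ _ (inj₁ (e′ , _))        = m≢1+n+m i (trans (sym e′) e)
  no-i+2-at-v3 _ e _ _ (inj₂ (inj₁ (e′ , _))) = m≢1+n+m i (trans (sym e′) (cong suc e))
  no-i+2-at-v3 _ e _ _ (inj₂ (inj₂ (e′ , _))) = 1+n≢n (trans (sym e) e′)

  W₁ : List ℤ
  W₁ = + i ∷ (+ i - 1ℤ) ∷ + suc i ∷ + i ∷ []

  open Generation {n} M class i cᵢ cᵢ₊₁ toℕ-cᵢ toℕ-cᵢ₊₁
    (inj₁ (toℕ-cᵢ , inj₁ (refl , refl))) (inj₁ (toℕ-cᵢ , inj₂ (refl , refl)))
    (inj₂ (inj₂ (toℕ-cᵢ₊₁ , inj₁ (refl , refl)))) (inj₂ (inj₂ (toℕ-cᵢ₊₁ , inj₂ (refl , refl))))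
    no-i-at-v3 no-i+2-at-v3 Φ base W₁

  target-W₁ : ∀ {c} → suc (toℕ c) ≡ i → target M W₁ Φ ≡ Φ ^ cᵢ ^ c ^ cᵢ₊₁ ^ cᵢ
  target-W₁ {c} e = target-inRange {W₁} Φ (toColour-i ∷ toColour-pred c e ∷ toColour-i+1 ∷ toColour-i ∷ [])

  Φ∼Φ^W₁ : ∀ {c} → suc (toℕ c) ≡ i → Orb M Φ (Φ ^ cᵢ ^ c ^ cᵢ₊₁ ^ cᵢ)
  Φ∼Φ^W₁ e = Φ∼from-v3 (orbit-step v2∼Φ^i (λ ()) (inj₂ (inj₁ (e , inj₁ (refl , refl)))))

  -- α_{i,i-1,i+1,i} maps R v3 to (R v2)^{i-1}, so its inverse maps R v2 to (R v3)^{i-1}.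
  moves-i-1 : ∀ {c} → suc (toℕ c) ≡ i → Covered R (R v2 ^ c) × Covered R (R v3 ^ c)
  moves-i-1 {c} e =
      covered-by α-W₁ v3 (^-cancel₂ _ cᵢ₊₁ cᵢ)
    , covered-by⁻¹ α-W₁ v2 (cᵢ ∷ cᵢ₊₁ ∷ c ∷ []) (trans (cong (_^ c) (^-cancel₂ _ cᵢ₊₁ cᵢ)) (invol c _))
    where α-W₁ = α-word (here refl) (target-W₁ e) (Φ∼Φ^W₁ e)

  generating-set : IsGeneratingSet M i (words3i i) Φ
  generating-set = generating (subst (Orb M Φ) (sym (target-W₁ toℕ-cᵢ₋₁)) (Φ∼Φ^W₁ toℕ-cᵢ₋₁)) (λ _ → moves-i-1)

corollary5p4 : ∀ {n : ℕ} (M : Maniplex n) → IsThreeOrbit M →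
      (∀ (i : ℕ) → 1 ≤ i → suc i < n → Class3i M i →
         ∀ Φ → BaseFlag M i Φ → IsGeneratingSet M i (words3i i) Φ)
    × (∀ (i : ℕ) → suc i < n → Class3ii1 M i →
         ∀ Φ → BaseFlag M i Φ → IsGeneratingSet M i (words3ii1 i) Φ)
corollary5p4 M _ = class3i , class3ii1
  where
  class3i : ∀ i → 1 ≤ i → suc i < _ → Class3i M i → ∀ Φ → BaseFlag M i Φ → IsGeneratingSet M i (words3i i) Φ
  class3i (suc m) _ i+1<n class Φ base =
    Class3iGeneration.generating-set M (suc m) i+1<n (fromℕ< m<n) (cong suc (toℕ-fromℕ< m<n)) class Φ base
    where m<n = <-trans (n<1+n m) (<-trans (n<1+n (suc m)) i+1<n)

  class3ii1 : ∀ i → suc i < _ → Class3ii1 M i → ∀ Φ → BaseFlag M i Φ → IsGeneratingSet M i (words3ii1 i) Φ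
  class3ii1 i i+1<n class Φ base = Class3ii1Generation.generating-set M i i+1<n class Φ base
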